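{- Let $T$ be a tree with $n$ vertices and independence number $\alpha$. Then \[ mis(T) \geq f(n-\alpha+2). \] Moreover, this inequality is sharp: for every integer $n \geq 2$ and every integer $\alpha$ with $\lceil n/2 \rceil \leq \alpha \leq n-1$, there exists a tree with $n$ vertices and independence number $\alpha$ for which equality holds.
   Context: All graphs are simple and finite. An independent set of a graph $G$ is a set of pairwise non-adjacent vertices; a maximal independent set is an independent set not properly contained in another independent set. $mis(G)$ denotes the number of maximal independent sets of $G$, and the independence number $\alpha(G)$ is the maximum size of an independent set. $f(n)$ denotes the $n$th Fibonacci number: $f(0)=0$, $f(1)=1$, and $f(n)=f(n-1)+f(n-2)$ for $n\geq 2$. -}

module Defs where

open import Data.Nat using (ℕ; zero; suc; _+_; _≤_)
open import Data.Bool using (Bool; true; false)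
import Data.Bool.Properties as BoolP
open import Data.Fin using (Fin)
open import Data.Fin.Subset using (Subset; inside; outside; _∈_; _⊂_; ∣_∣)
open import Data.Fin.Subset.Properties using (_∈?_; _⊂?_; anySubset?)
open import Data.Fin.Properties using (all?)
open import Data.Vec using (_∷_; [])
open import Data.List using (List; []; _∷_; length; filter; map; _++_; _∷ʳ_)
open import Data.List.Relation.Unary.Linked using (Linked)
open import Data.List.Relation.Unary.Unique.Propositional using (Unique)
open import Data.Product using (Σ; ∃; _×_; _,_)
open import Relation.Binary.PropositionalEquality using (_≡_)
open import Relation.Nullary using (Dec; yes; no; ¬_; _×-dec_; ¬?)
open import Relation.Nullary.Decidable using (_→-dec_)

fib : ℕ → ℕ
fib zero          = 0
fib (suc zero)    = 1
fib (suc (suc n)) = fib (suc n) + fib n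

record Graph (n : ℕ) : Set where
  field
    adj     : Fin n → Fin n → Bool
    symm    : ∀ u v → adj u v ≡ adj v u
    irrefl  : ∀ v → adj v v ≡ false
open Graph public

module _ {n : ℕ} (G : Graph n) where

  Edge : Fin n → Fin n → Set
  Edge u v = adj G u v ≡ true

  data Walk : Fin n → Fin n → Set where
    [] : ∀ {v} → Walk v v
    _∷_ : ∀ {u v w} → Edge u v → Walk v w → Walk u w

  Connected : Set
  Connected = ∀ u v → Walk u v

  -- a cycle: distinct vertices v0, m1, ..., mk, w (k ≥ 1, so at least
  -- three vertices), consecutive ones adjacent, and w adjacent to v0
  HasCycle : Set
  HasCycle = Σ (Fin n) λ v₀ → Σ (Fin n) λ w → Σ (List (Fin n)) λ mid →
    1 ≤ length mid ×
    Linked Edge (v₀ ∷ (mid ∷ʳ w)) ×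
    Unique (v₀ ∷ (mid ∷ʳ w)) ×
    Edge w v₀

  Acyclic : Set
  Acyclic = ¬ HasCycle

  IsTree : Set
  IsTree = 1 ≤ n × Connected × Acyclic

  Independent : Subset n → Set
  Independent S = ∀ u v → u ∈ S → v ∈ S → adj G u v ≡ false

  MaximalIndependent : Subset n → Set
  MaximalIndependent S = Independent S × (∀ T → Independent T → ¬ (S ⊂ T))

  IsIndependenceNumber : ℕ → Set
  IsIndependenceNumber α =
    (Σ (Subset n) λ S → Independent S × ∣ S ∣ ≡ α) ×
    (∀ S → Independent S → ∣ S ∣ ≤ α)

  independent? : ∀ S → Dec (Independent S)
  independent? S = all? λ u → all? λ v →
    (u ∈? S) →-dec ((v ∈? S) →-dec (adj G u v BoolP.≟ false))

  maximalIndependent? : ∀ S → Dec (MaximalIndependent S)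
  maximalIndependent? S with independent? S | anySubset? (λ T → independent? T ×-dec (S ⊂? T))
  ... | no ¬i  | _              = no λ { (i , _) → ¬i i }
  ... | yes i  | yes (T , iT , s⊂T) = no λ { (_ , m) → m T iT s⊂T }
  ... | yes i  | no ¬e           = yes (i , λ T iT s⊂T → ¬e (T , iT , s⊂T))

allSubsets : (n : ℕ) → List (Subset n)
allSubsets zero    = [] ∷ []
allSubsets (suc n) = map (inside ∷_) (allSubsets n) ++ map (outside ∷_) (allSubsets n)

mis : ∀ {n} → Graph n → ℕ
mis {n} G = length (filter (maximalIndependent? G) (allSubsets n))

{-# OPTIONS --safe #-}
-- Count maximal independent sets of induced subgraphs G[W]. If v is a leaf of G[W]
-- attached to u, a maximal independent set contains v exactly when it avoids u, so
-- mis(W) = mis(W ∖ N[u]) + mis(W ∖ N[v]). At the end of a longest path of a forest,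
-- all neighbours of u but one are leaves; hence removing N[v] lowers the deficit
-- |W| − α(G[W]) by at most one and removing N[u] by at most two, and induction on |W|
-- with the Fibonacci recurrence gives mis(W) ≥ f(deficit + 2).
-- Equality holds for a comb: a path of k spine vertices, each with one pendant leaf,
-- and all remaining vertices attached to the last spine vertex. Removing the first
-- spine vertex and its leaf lowers the deficit by one, and the two removals above
-- reproduce the Fibonacci recurrence exactly.
module Submission where

open import Defs
open import Data.Bool using (true; false; not)
import Data.Bool.Properties as Bool
open import Data.Empty using (⊥; ⊥-elim)
open import Data.Fin using (Fin; zero; suc; toℕ; fromℕ<) renaming (_<_ to _<ᶠ_)
open import Data.Fin.Properties
  using (all?; any?; pigeonhole; toℕ-injective; toℕ-fromℕ<; toℕ<n) renaming (_≟_ to _≟ᶠ_)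
open import Data.Fin.Subset
  using (Subset; inside; outside; _∈_; _∉_; _⊆_; _⊂_; _∪_; _∩_; ⁅_⁆; ⊤; ∣_∣)
open import Data.Fin.Subset.Properties
  using (_∈?_; _⊆?_; ⊆-antisym; ∪-identityʳ; ∈⊤; ⊆⊤; ∣⊤∣≡n; ∣p∣≤n; p⊆p∪q; x∈⁅x⁆; x∈⁅y⁆⇒x≡y;
         ∣⁅x⁆∣≡1; x∈p∪q⁺; x∈p∪q⁻; x∈p∩q⁺; p∩q⊆p; p∩q⊆q; p⊆q⇒∣p∣≤∣q∣; p⊂q⇒∣p∣<∣q∣; ∣p∣≤∣x∷p∣)
open import Data.List using (List; []; _∷_; length; filter; map; _++_; _∷ʳ_; lookup)
open import Data.List.Membership.Propositional using () renaming (_∈_ to _∈ˡ_)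
open import Data.List.Membership.Propositional.Properties using (∈-∃++; ∈-lookup)
open import Data.List.Properties using (filter-++; length-++; filter-≐; filter-none; filter-accept)
open import Data.List.Relation.Unary.All as All using (All; []; _∷_)
import Data.List.Relation.Unary.All.Properties as Allₚ
open import Data.List.Relation.Unary.AllPairs using ([]; _∷_)
open import Data.List.Relation.Unary.Linked using (Linked; []; [-]; _∷_)
open import Data.List.Relation.Unary.Unique.Propositional using (Unique)
open import Data.Nat
  using (ℕ; zero; suc; _+_; _∸_; _≤_; _<_; _≤?_; _<?_; z≤n; s≤s; s≤s⁻¹; ⌊_/2⌋; ⌈_/2⌉)
import Data.Nat as ℕ
open import Data.Nat.Induction using (<-wellFounded)
open import Data.Nat.Properties
open import Algebra.Properties.CommutativeSemigroup +-commutativeSemigroup using (xy∙z≈xz∙y)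
open import Data.Product using (Σ; ∃-syntax; _×_; _,_; proj₁; proj₂)
open import Data.Sum using (_⊎_; inj₁; inj₂; [_,_]′; swap)
import Data.Sum as Sum
open import Data.Vec using (_∷_; []; here; there; tabulate; _[_]%=_)
open import Data.Vec.Properties
  using (lookup∘tabulate; []=⇒lookup; lookup⇒[]=; ∷-injectiveˡ; ∷-injectiveʳ)
open import Function using (_∘_; mk⇔)
open import Induction.WellFounded using (Acc; acc)
open import Level using (0ℓ)
open import Relation.Binary.PropositionalEquality
  using (_≡_; _≢_; refl; sym; trans; cong; cong₂; subst; ≢-sym; module ≡-Reasoning)
open import Relation.Nullary
  using (Dec; yes; no; does; ¬_; contradiction; ¬?; _×-dec_; _⊎-dec_; _→-dec_)
open import Relation.Nullary.Decidable using (dec-true; dec-false; does-⇔; decidable-stable)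
open import Relation.Unary using (Pred; Decidable; _≐_)
open import Relation.Unary.Properties using (_∩?_; ∁?)

private
  variable
    n : ℕ

fib-split : ∀ d → fib (d + 2) ≤ fib (d ∸ 2 + 2) + fib (d ∸ 1 + 2)
fib-split zero          = s≤s z≤n
fib-split (suc zero)    = ≤-refl
fib-split (suc (suc d)) = ≤-reflexive (+-comm (fib (suc (d + 2))) (fib (d + 2)))

-- the hypothesis m ≤ n covers the case p > o, where o ∸ p truncates to 0
m≤n∧m+o≤p+n⇒m+[o∸p]≤n : ∀ {m n} o p → m ≤ n → m + o ≤ p + n → m + (o ∸ p) ≤ n
m≤n∧m+o≤p+n⇒m+[o∸p]≤n {m} o       zero    _   le = le
m≤n∧m+o≤p+n⇒m+[o∸p]≤n {m} zero    (suc p) m≤n _  = ≤-trans (≤-reflexive (+-identityʳ m)) m≤n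
m≤n∧m+o≤p+n⇒m+[o∸p]≤n {m} {n} (suc o) (suc p) m≤n le =
  m≤n∧m+o≤p+n⇒m+[o∸p]≤n o p m≤n (s≤s⁻¹ (subst (_≤ suc (p + n)) (+-suc m o) le))

countSubsets : {P : Pred (Subset n) 0ℓ} → Decidable P → ℕ
countSubsets {n} P? = length (filter P? (allSubsets n))

module _ {A B : Set} {P : Pred B 0ℓ} (P? : Decidable P) (f : A → B) where

  length-filter-map : ∀ xs → length (filter P? (map f xs)) ≡ length (filter (P? ∘ f) xs)
  length-filter-map []       = refl
  length-filter-map (x ∷ xs) with does (P? (f x))
  ... | true  = cong suc (length-filter-map xs)
  ... | false = length-filter-map xs

module _ {A : Set} {P Q : Pred A 0ℓ} (P? : Decidable P) (Q? : Decidable Q) where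

  length-filter-∩∁ : ∀ xs →
    length (filter P? xs) ≡ length (filter (P? ∩? Q?) xs) + length (filter (P? ∩? ∁? Q?) xs)
  length-filter-∩∁ []       = refl
  length-filter-∩∁ (x ∷ xs) with P? x | Q? x
  ... | yes _ | yes _ = cong suc (length-filter-∩∁ xs)
  ... | yes _ | no  _ = trans (cong suc (length-filter-∩∁ xs)) (sym (+-suc _ _))
  ... | no  _ | yes _ = length-filter-∩∁ xs
  ... | no  _ | no  _ = length-filter-∩∁ xs

module _ {P : Pred (Subset (suc n)) 0ℓ} (P? : Decidable P) where

  count-∷ : countSubsets P? ≡ countSubsets (P? ∘ (inside ∷_)) + countSubsets (P? ∘ (outside ∷_))
  count-∷ = begin
    length (filter P? (map (inside ∷_) Ss ++ map (outside ∷_) Ss))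
      ≡⟨ cong length (filter-++ P? (map (inside ∷_) Ss) (map (outside ∷_) Ss)) ⟩
    length (filter P? (map (inside ∷_) Ss) ++ filter P? (map (outside ∷_) Ss))
      ≡⟨ length-++ (filter P? (map (inside ∷_) Ss)) ⟩
    length (filter P? (map (inside ∷_) Ss)) + length (filter P? (map (outside ∷_) Ss))
      ≡⟨ cong₂ _+_ (length-filter-map P? (inside ∷_) Ss) (length-filter-map P? (outside ∷_) Ss) ⟩
    countSubsets (P? ∘ (inside ∷_)) + countSubsets (P? ∘ (outside ∷_)) ∎
    where
    open ≡-Reasoning
    Ss = allSubsets n

module _ {P Q : Pred (Subset n) 0ℓ} (P? : Decidable P) (Q? : Decidable Q) where

  count-≐ : P ≐ Q → countSubsets P? ≡ countSubsets Q?
  count-≐ P≐Q = cong length (filter-≐ P? Q? P≐Q (allSubsets n))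

  count-∩∁ : countSubsets P? ≡ countSubsets (P? ∩? Q?) + countSubsets (P? ∩? ∁? Q?)
  count-∩∁ = length-filter-∩∁ P? Q? (allSubsets n)

count-none : {P : Pred (Subset n) 0ℓ} (P? : Decidable P) → (∀ S → ¬ P S) → countSubsets P? ≡ 0
count-none {n} P? ¬P = cong length (filter-none P? (All.universal ¬P (allSubsets n)))

count-unique : {P : Pred (Subset n) 0ℓ} (P? : Decidable P) {S₀ : Subset n} →
  P S₀ → (∀ {S} → P S → S ≡ S₀) → countSubsets P? ≡ 1
count-unique P? {[]} p _ = cong length (filter-accept P? p)
count-unique P? {inside ∷ S₀} p unique = begin
  countSubsets P?                                                  ≡⟨ count-∷ P? ⟩
  countSubsets (P? ∘ (inside ∷_)) + countSubsets (P? ∘ (outside ∷_)) ≡⟨ cong₂ _+_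
    (count-unique (P? ∘ (inside ∷_)) p (∷-injectiveʳ ∘ unique))
    (count-none (P? ∘ (outside ∷_)) λ _ → (λ ()) ∘ ∷-injectiveˡ ∘ unique) ⟩
  1 ∎
  where open ≡-Reasoning
count-unique P? {outside ∷ S₀} p unique = begin
  countSubsets P?                                                  ≡⟨ count-∷ P? ⟩
  countSubsets (P? ∘ (inside ∷_)) + countSubsets (P? ∘ (outside ∷_)) ≡⟨ cong₂ _+_
    (count-none (P? ∘ (inside ∷_)) λ _ → (λ ()) ∘ ∷-injectiveˡ ∘ unique)
    (count-unique (P? ∘ (outside ∷_)) p (∷-injectiveʳ ∘ unique)) ⟩
  1 ∎
  where open ≡-Reasoning

toggle : Fin n → Subset n → Subset n
toggle x S = S [ x ]%= not

count-toggle : (x : Fin n) {P : Pred (Subset n) 0ℓ} (P? : Decidable P) →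
  countSubsets P? ≡ countSubsets (P? ∘ toggle x)
count-toggle zero P? = trans (count-∷ P?) (trans
  (+-comm (countSubsets (P? ∘ (inside ∷_))) (countSubsets (P? ∘ (outside ∷_))))
  (sym (count-∷ (P? ∘ toggle zero))))
count-toggle (suc x) P? = begin
  countSubsets P?                                                    ≡⟨ count-∷ P? ⟩
  countSubsets (P? ∘ (inside ∷_)) + countSubsets (P? ∘ (outside ∷_))
    ≡⟨ cong₂ _+_ (count-toggle x (P? ∘ (inside ∷_))) (count-toggle x (P? ∘ (outside ∷_))) ⟩
  countSubsets (P? ∘ toggle (suc x) ∘ (inside ∷_)) + countSubsets (P? ∘ toggle (suc x) ∘ (outside ∷_))
    ≡⟨ count-∷ (P? ∘ toggle (suc x)) ⟨
  countSubsets (P? ∘ toggle (suc x)) ∎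
  where open ≡-Reasoning

⟦_⟧ : {P : Pred (Fin n) 0ℓ} → Decidable P → Subset n
⟦ P? ⟧ = tabulate (does ∘ P?)

module _ {P : Pred (Fin n) 0ℓ} (P? : Decidable P) {x : Fin n} where

  ∈⟦⟧⁺ : P x → x ∈ ⟦ P? ⟧
  ∈⟦⟧⁺ p = lookup⇒[]= x ⟦ P? ⟧ (trans (lookup∘tabulate (does ∘ P?) x) (dec-true (P? x) p))

  ∈⟦⟧⁻ : x ∈ ⟦ P? ⟧ → P x
  ∈⟦⟧⁻ x∈ with P? x | trans (sym (lookup∘tabulate (does ∘ P?) x)) ([]=⇒lookup x∈)
  ... | yes p | _ = p
  ... | no _  | ()

∣p∪q∣≤∣p∣+∣q∣ : ∀ (p q : Subset n) → ∣ p ∪ q ∣ ≤ ∣ p ∣ + ∣ q ∣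
∣p∪q∣≤∣p∣+∣q∣ []            []            = z≤n
∣p∪q∣≤∣p∣+∣q∣ (inside  ∷ p) (y ∷ q)       =
  s≤s (≤-trans (∣p∪q∣≤∣p∣+∣q∣ p q) (+-monoʳ-≤ ∣ p ∣ (∣p∣≤∣x∷p∣ y q)))
∣p∪q∣≤∣p∣+∣q∣ (outside ∷ p) (inside  ∷ q) =
  ≤-trans (s≤s (∣p∪q∣≤∣p∣+∣q∣ p q)) (≤-reflexive (sym (+-suc ∣ p ∣ ∣ q ∣)))
∣p∪q∣≤∣p∣+∣q∣ (outside ∷ p) (outside ∷ q) = ∣p∪q∣≤∣p∣+∣q∣ p q

∣p∪q∣≡∣p∣+∣q∣ : ∀ (p q : Subset n) → (∀ {x} → x ∈ p → x ∉ q) → ∣ p ∪ q ∣ ≡ ∣ p ∣ + ∣ q ∣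
∣p∪q∣≡∣p∣+∣q∣ []            []            _        = refl
∣p∪q∣≡∣p∣+∣q∣ (inside  ∷ p) (inside  ∷ q) disjoint = contradiction here (disjoint here)
∣p∪q∣≡∣p∣+∣q∣ (inside  ∷ p) (outside ∷ q) disjoint =
  cong suc (∣p∪q∣≡∣p∣+∣q∣ p q λ x∈p x∈q → disjoint (there x∈p) (there x∈q))
∣p∪q∣≡∣p∣+∣q∣ (outside ∷ p) (inside  ∷ q) disjoint =
  trans (cong suc (∣p∪q∣≡∣p∣+∣q∣ p q λ x∈p x∈q → disjoint (there x∈p) (there x∈q)))
        (sym (+-suc ∣ p ∣ ∣ q ∣))
∣p∪q∣≡∣p∣+∣q∣ (outside ∷ p) (outside ∷ q) disjoint =
  ∣p∪q∣≡∣p∣+∣q∣ p q λ x∈p x∈q → disjoint (there x∈p) (there x∈q)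

∣⁅x⁆∪⁅y⁆∣≤2 : ∀ (x y : Fin n) → ∣ ⁅ x ⁆ ∪ ⁅ y ⁆ ∣ ≤ 2
∣⁅x⁆∪⁅y⁆∣≤2 x y = subst (∣ ⁅ x ⁆ ∪ ⁅ y ⁆ ∣ ≤_) (cong₂ _+_ (∣⁅x⁆∣≡1 x) (∣⁅x⁆∣≡1 y)) (∣p∪q∣≤∣p∣+∣q∣ ⁅ x ⁆ ⁅ y ⁆)

p⊆q∪r⇒∣p∣≤∣q∣+∣r∣ : ∀ {p} (q r : Subset n) → p ⊆ q ∪ r → ∣ p ∣ ≤ ∣ q ∣ + ∣ r ∣
p⊆q∪r⇒∣p∣≤∣q∣+∣r∣ q r p⊆q∪r = ≤-trans (p⊆q⇒∣p∣≤∣q∣ p⊆q∪r) (∣p∪q∣≤∣p∣+∣q∣ q r)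

∣p∪⁅x⁆∣≡1+∣p∣ : ∀ {p : Subset n} {x} → x ∉ p → ∣ p ∪ ⁅ x ⁆ ∣ ≡ suc ∣ p ∣
∣p∪⁅x⁆∣≡1+∣p∣ {p = p} {x} x∉p = begin
  ∣ p ∪ ⁅ x ⁆ ∣     ≡⟨ ∣p∪q∣≡∣p∣+∣q∣ p ⁅ x ⁆ (λ y∈p y∈⁅x⁆ → x∉p (subst (_∈ p) (x∈⁅y⁆⇒x≡y x y∈⁅x⁆) y∈p)) ⟩
  ∣ p ∣ + ∣ ⁅ x ⁆ ∣ ≡⟨ cong (∣ p ∣ +_) (∣⁅x⁆∣≡1 x) ⟩
  ∣ p ∣ + 1         ≡⟨ +-comm ∣ p ∣ 1 ⟩
  suc ∣ p ∣         ∎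
  where open ≡-Reasoning

x∈toggle[x]⇒x∉ : ∀ {x : Fin n} {S} → x ∈ toggle x S → x ∉ S
x∈toggle[x]⇒x∉ {x = zero}  {inside  ∷ S} ()
x∈toggle[x]⇒x∉ {x = zero}  {outside ∷ S} _ ()
x∈toggle[x]⇒x∉ {x = suc x} {_ ∷ S} (there x∈) (there x∈S) = x∈toggle[x]⇒x∉ x∈ x∈S

toggle-∉ : ∀ {x : Fin n} {S} → x ∉ S → toggle x S ≡ S ∪ ⁅ x ⁆
toggle-∉ {x = zero}  {inside  ∷ S} x∉ = contradiction here x∉
toggle-∉ {x = zero}  {outside ∷ S} _  = cong (inside ∷_) (sym (∪-identityʳ S))
toggle-∉ {x = suc x} {b ∷ S}       x∉ =
  cong₂ _∷_ (sym (Bool.∨-identityʳ b)) (toggle-∉ (x∉ ∘ there))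

headOr : {A : Set} → A → List A → A
headOr x []      = x
headOr _ (y ∷ _) = y

module _ {A : Set} where

  Linked-∷ʳ⁻ : ∀ {R : A → A → Set} (xs : List A) {y ys} → Linked R (xs ++ y ∷ ys) → Linked R (xs ∷ʳ y)
  Linked-∷ʳ⁻ []            _         = [-]
  Linked-∷ʳ⁻ (x ∷ [])      (r ∷ _)   = r ∷ [-]
  Linked-∷ʳ⁻ (x ∷ x′ ∷ xs) (r ∷ rs)  = r ∷ Linked-∷ʳ⁻ (x′ ∷ xs) rs

  Unique-∷ʳ⁻ : ∀ (xs : List A) {y ys} → Unique (xs ++ y ∷ ys) → Unique (xs ∷ʳ y)
  Unique-∷ʳ⁻ []       (_ ∷ _)      = [] ∷ []
  Unique-∷ʳ⁻ (x ∷ xs) (x∉ ∷ uniq)  =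
    let (x∉xs , x∉y∷ys) = Allₚ.++⁻ xs x∉ in Allₚ.∷ʳ⁺ x∉xs (All.head x∉y∷ys) ∷ Unique-∷ʳ⁻ xs uniq

  Unique-lookup-injective : ∀ {xs : List A} → Unique xs → ∀ {i j} → i <ᶠ j → lookup xs i ≢ lookup xs j
  Unique-lookup-injective (x∉ ∷ _)   {zero}  {suc j} _         = All.lookup x∉ (∈-lookup j)
  Unique-lookup-injective (_ ∷ uniq) {suc i} {suc j} (s≤s i<j) = Unique-lookup-injective uniq i<j

Unique⇒length≤ : ∀ {xs : List (Fin n)} → Unique xs → length xs ≤ n
Unique⇒length≤ {n} {xs} uniq with length xs ≤? n
... | yes ≤n = ≤n
... | no  ≰n = let (i , j , i<j , same) = pigeonhole (≰⇒> ≰n) (lookup xs) in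
  contradiction same (Unique-lookup-injective uniq i<j)

-- Maximal independent sets of induced subgraphs

module Induced (G : Graph n) where

  edge? : ∀ x y → Dec (Edge G x y)
  edge? x y = adj G x y Bool.≟ true

  Edge-sym : ∀ {x y} → Edge G x y → Edge G y x
  Edge-sym {x} {y} = trans (symm G y x)

  Edge-irrefl : ∀ {x} → ¬ Edge G x x
  Edge-irrefl {x} x~x with trans (sym x~x) (irrefl G x)
  ... | ()

  Independent⇒¬Edge : ∀ {S x y} → Independent G S → x ∈ S → y ∈ S → ¬ Edge G x y
  Independent⇒¬Edge {x = x} {y} indS x∈S y∈S x~y with trans (sym x~y) (indS x y x∈S y∈S)
  ... | ()

  Independent-⊆ : ∀ {S T} → S ⊆ T → Independent G T → Independent G S
  Independent-⊆ S⊆T indT x y x∈S y∈S = indT x y (S⊆T x∈S) (S⊆T y∈S)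

  Independent-⁅⁆ : ∀ x → Independent G ⁅ x ⁆
  Independent-⁅⁆ x u v u∈ v∈
    rewrite x∈⁅y⁆⇒x≡y x u∈ | x∈⁅y⁆⇒x≡y x v∈ = irrefl G x

  Independent-∪ : ∀ {S T} → Independent G S → Independent G T →
    (∀ {x y} → x ∈ S → y ∈ T → ¬ Edge G x y) → Independent G (S ∪ T)
  Independent-∪ {S} {T} indS indT cross x y x∈ y∈ with x∈p∪q⁻ S T x∈ | x∈p∪q⁻ S T y∈
  ... | inj₁ x∈S | inj₁ y∈S = indS x y x∈S y∈S
  ... | inj₁ x∈S | inj₂ y∈T = Bool.¬-not (cross x∈S y∈T)
  ... | inj₂ x∈T | inj₁ y∈S = Bool.¬-not (cross y∈S x∈T ∘ Edge-sym)
  ... | inj₂ x∈T | inj₂ y∈T = indT x y x∈T y∈T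

  EdgelessIn : Subset n → Set
  EdgelessIn W = ∀ {x y} → x ∈ W → y ∈ W → ¬ Edge G x y

  Edgeless⇒Independent : ∀ {W} → EdgelessIn W → Independent G W
  Edgeless⇒Independent edgeless x y x∈ y∈ = Bool.¬-not (edgeless x∈ y∈)

  _∖N[_] : Subset n → Fin n → Subset n
  W ∖N[ x ] = ⟦ (_∈? W) ∩? ∁? (λ y → (y ≟ᶠ x) ⊎-dec edge? x y) ⟧

  module _ {W : Subset n} {x y : Fin n} where

    ∈∖N⁻ : y ∈ W ∖N[ x ] → y ∈ W × y ≢ x × ¬ Edge G x y
    ∈∖N⁻ y∈ with ∈⟦⟧⁻ ((_∈? W) ∩? ∁? (λ y → (y ≟ᶠ x) ⊎-dec edge? x y)) y∈
    ... | y∈W , ¬near = y∈W , ¬near ∘ inj₁ , ¬near ∘ inj₂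

    ∈∖N⁺ : y ∈ W → y ≢ x → ¬ Edge G x y → y ∈ W ∖N[ x ]
    ∈∖N⁺ y∈W y≢x x≁y = ∈⟦⟧⁺ ((_∈? W) ∩? ∁? (λ y → (y ≟ᶠ x) ⊎-dec edge? x y))
      (y∈W , λ { (inj₁ y≡x) → y≢x y≡x ; (inj₂ x~y) → x≁y x~y })

  ∖N-⊆ : ∀ {W x} → W ∖N[ x ] ⊆ W
  ∖N-⊆ = proj₁ ∘ ∈∖N⁻

  x∉∖N[x] : ∀ {W x} → x ∉ W ∖N[ x ]
  x∉∖N[x] x∈ = proj₁ (proj₂ (∈∖N⁻ x∈)) refl

  ∣∖N∣<∣∣ : ∀ {W x} → x ∈ W → ∣ W ∖N[ x ] ∣ < ∣ W ∣
  ∣∖N∣<∣∣ {x = x} x∈W = p⊂q⇒∣p∣<∣q∣ (∖N-⊆ , x , x∈W , x∉∖N[x])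

  Dominates : Subset n → Subset n → Set
  Dominates S W = ∀ x → x ∈ W → x ∉ S → ∃[ y ] y ∈ S × Edge G x y

  MaximalIndependentIn : Subset n → Subset n → Set
  MaximalIndependentIn W S = S ⊆ W × Independent G S × Dominates S W

  maximalIndependentIn? : ∀ W → Decidable (MaximalIndependentIn W)
  maximalIndependentIn? W S = S ⊆? W ×-dec independent? G S ×-dec
    all? λ x → x ∈? W →-dec (¬? (x ∈? S) →-dec any? λ y → y ∈? S ×-dec edge? x y)

  misIn : Subset n → ℕ
  misIn W = countSubsets (maximalIndependentIn? W)

  misIn-⊤ : mis G ≡ misIn ⊤
  misIn-⊤ = count-≐ (maximalIndependent? G) (maximalIndependentIn? ⊤) (to , from)
    where
    to : ∀ {S} → MaximalIndependent G S → MaximalIndependentIn ⊤ S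
    to {S} (indS , maximal) = ⊆⊤ , indS , dom
      where
      dom : Dominates S ⊤
      dom x _ x∉S with any? (λ y → y ∈? S ×-dec edge? x y)
      ... | yes dominated = dominated
      ... | no ¬dominated = ⊥-elim (maximal (S ∪ ⁅ x ⁆)
        (Independent-∪ indS (Independent-⁅⁆ x) λ {y} y∈S z∈ y~z →
          ¬dominated (y , y∈S , Edge-sym (subst (Edge G y) (x∈⁅y⁆⇒x≡y x z∈) y~z)))
        (p⊆p∪q ⁅ x ⁆ , x , x∈p∪q⁺ (inj₂ (x∈⁅x⁆ x)) , x∉S))
    from : ∀ {S} → MaximalIndependentIn ⊤ S → MaximalIndependent G S
    from (_ , indS , dom) = indS , λ { T indT (S⊆T , x , x∈T , x∉S) →
      let (y , y∈S , x~y) = dom x ∈⊤ x∉S in Independent⇒¬Edge indT x∈T (S⊆T y∈S) x~y }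

  misIn-edgeless : ∀ {W} → EdgelessIn W → misIn W ≡ 1
  misIn-edgeless {W} edgeless = count-unique (maximalIndependentIn? W) W-maximal W-unique
    where
    W-maximal : MaximalIndependentIn W W
    W-maximal = (λ x∈ → x∈) , Edgeless⇒Independent edgeless , λ _ x∈ x∉ → contradiction x∈ x∉
    W-unique : ∀ {S} → MaximalIndependentIn W S → S ≡ W
    W-unique {S} (S⊆W , _ , dom) = ⊆-antisym S⊆W λ {x} x∈W →
      decidable-stable (x ∈? S) λ x∉S → let (y , y∈S , x~y) = dom x x∈W x∉S in edgeless x∈W (S⊆W y∈S) x~y

  ∪⁅⁆-independent : ∀ {W S x} → x ∈ W → S ⊆ W ∖N[ x ] → Independent G S →
    S ∪ ⁅ x ⁆ ⊆ W × Independent G (S ∪ ⁅ x ⁆)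
  ∪⁅⁆-independent {W} {S} {x} x∈W S⊆ indS = ⊆W , ind
    where
    ⊆W : S ∪ ⁅ x ⁆ ⊆ W
    ⊆W y∈ with x∈p∪q⁻ S ⁅ x ⁆ y∈
    ... | inj₁ y∈S = ∖N-⊆ (S⊆ y∈S)
    ... | inj₂ y∈⁅x⁆ = subst (_∈ W) (sym (x∈⁅y⁆⇒x≡y x y∈⁅x⁆)) x∈W
    ind : Independent G (S ∪ ⁅ x ⁆)
    ind = Independent-∪ indS (Independent-⁅⁆ x) λ y∈S z∈ y~z →
      proj₂ (proj₂ (∈∖N⁻ (S⊆ y∈S))) (Edge-sym (subst (Edge G _) (x∈⁅y⁆⇒x≡y x z∈) y~z))

  module _ {W S : Subset n} {x : Fin n} (x∉S : x ∉ S) where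

    maximalIndependentIn-∪⁅⁆⁺ : x ∈ W → MaximalIndependentIn (W ∖N[ x ]) S →
      MaximalIndependentIn W (S ∪ ⁅ x ⁆)
    maximalIndependentIn-∪⁅⁆⁺ x∈W (S⊆ , indS , domS) =
      let (⊆W , ind) = ∪⁅⁆-independent x∈W S⊆ indS in ⊆W , ind , dom
      where
      dom : Dominates (S ∪ ⁅ x ⁆) W
      dom y y∈W y∉ with edge? y x
      ... | yes y~x = x , x∈p∪q⁺ (inj₂ (x∈⁅x⁆ x)) , y~x
      ... | no y≁x =
        let (z , z∈S , y~z) = domS y (∈∖N⁺ y∈W y≢x (y≁x ∘ Edge-sym)) (y∉ ∘ x∈p∪q⁺ ∘ inj₁)
        in z , x∈p∪q⁺ (inj₁ z∈S) , y~z
        where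
        y≢x : y ≢ x
        y≢x refl = y∉ (x∈p∪q⁺ (inj₂ (x∈⁅x⁆ x)))

    maximalIndependentIn-∪⁅⁆⁻ : MaximalIndependentIn W (S ∪ ⁅ x ⁆) →
      MaximalIndependentIn (W ∖N[ x ]) S
    maximalIndependentIn-∪⁅⁆⁻ (⊆W , ind , dom) = S⊆ , Independent-⊆ (p⊆p∪q ⁅ x ⁆) ind , domS
      where
      x∈ : x ∈ S ∪ ⁅ x ⁆
      x∈ = x∈p∪q⁺ (inj₂ (x∈⁅x⁆ x))
      S⊆ : S ⊆ W ∖N[ x ]
      S⊆ {y} y∈S = ∈∖N⁺ (⊆W (p⊆p∪q ⁅ x ⁆ y∈S)) (λ { refl → x∉S y∈S })
        (Independent⇒¬Edge ind x∈ (p⊆p∪q ⁅ x ⁆ y∈S))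
      domS : Dominates S (W ∖N[ x ])
      domS y y∈ y∉S with ∈∖N⁻ y∈
      ... | y∈W , y≢x , x≁y with dom y y∈W ([ y∉S , y≢x ∘ x∈⁅y⁆⇒x≡y x ]′ ∘ x∈p∪q⁻ S ⁅ x ⁆)
      ... | z , z∈ , y~z with x∈p∪q⁻ S ⁅ x ⁆ z∈
      ... | inj₁ z∈S = z , z∈S , y~z
      ... | inj₂ z∈⁅x⁆ = ⊥-elim (x≁y (Edge-sym (subst (Edge G y) (x∈⁅y⁆⇒x≡y x z∈⁅x⁆) y~z)))

  module _ {W : Subset n} where

    -- toggling x maps the maximal independent sets of G[W ∖ N[x]] onto those of G[W] containing x
    misIn-∋ : ∀ {x} → x ∈ W →
      countSubsets (maximalIndependentIn? W ∩? (x ∈?_)) ≡ misIn (W ∖N[ x ])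
    misIn-∋ {x} x∈W = trans (count-toggle x (maximalIndependentIn? W ∩? (x ∈?_)))
      (count-≐ _ (maximalIndependentIn? (W ∖N[ x ])) (to , from))
      where
      to : ∀ {S} → MaximalIndependentIn W (toggle x S) × x ∈ toggle x S → MaximalIndependentIn (W ∖N[ x ]) S
      to (max , x∈) = let x∉ = x∈toggle[x]⇒x∉ x∈ in
        maximalIndependentIn-∪⁅⁆⁻ x∉ (subst (MaximalIndependentIn W) (toggle-∉ x∉) max)
      from : ∀ {S} → MaximalIndependentIn (W ∖N[ x ]) S → MaximalIndependentIn W (toggle x S) × x ∈ toggle x S
      from max@(S⊆ , _) = let x∉ = x∉∖N[x] ∘ S⊆ in
        subst (MaximalIndependentIn W) (sym (toggle-∉ x∉)) (maximalIndependentIn-∪⁅⁆⁺ x∉ x∈W max) ,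
        subst (x ∈_) (sym (toggle-∉ x∉)) (x∈p∪q⁺ (inj₂ (x∈⁅x⁆ x)))

    misIn-isolated : ∀ {x} → x ∈ W → (∀ {y} → y ∈ W → ¬ Edge G x y) → misIn W ≡ misIn (W ∖N[ x ])
    misIn-isolated {x} x∈W isolated =
      trans (count-≐ (maximalIndependentIn? W) _ ((λ max → max , x∈ max) , proj₁)) (misIn-∋ x∈W)
      where
      x∈ : ∀ {S} → MaximalIndependentIn W S → x ∈ S
      x∈ {S} (S⊆W , _ , dom) = decidable-stable (x ∈? S) λ x∉S →
        let (y , y∈S , x~y) = dom x x∈W x∉S in isolated (S⊆W y∈S) x~y

  record Pendant (W : Subset n) (u v : Fin n) : Set where
    field
      support∈ : u ∈ W
      leaf∈    : v ∈ W
      edge     : Edge G v u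
      only     : ∀ {y} → y ∈ W → Edge G v y → y ≡ u

  misIn-pendant : ∀ {W u v} → Pendant W u v → misIn W ≡ misIn (W ∖N[ u ]) + misIn (W ∖N[ v ])
  misIn-pendant {W} {u} {v} p = begin
    misIn W
      ≡⟨ count-∩∁ (maximalIndependentIn? W) (u ∈?_) ⟩
    countSubsets (maximalIndependentIn? W ∩? (u ∈?_)) + countSubsets (maximalIndependentIn? W ∩? ∁? (u ∈?_))
      ≡⟨ cong₂ _+_ (misIn-∋ support∈) (trans (count-≐ (maximalIndependentIn? W ∩? ∁? (u ∈?_))
                    (maximalIndependentIn? W ∩? (v ∈?_)) (to , from)) (misIn-∋ leaf∈)) ⟩
    misIn (W ∖N[ u ]) + misIn (W ∖N[ v ]) ∎
    where
    open ≡-Reasoning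
    open Pendant p
    to : ∀ {S} → MaximalIndependentIn W S × u ∉ S → MaximalIndependentIn W S × v ∈ S
    to {S} (max@(S⊆W , _ , dom) , u∉S) = max , decidable-stable (v ∈? S) λ v∉S →
      let (y , y∈S , v~y) = dom v leaf∈ v∉S in u∉S (subst (_∈ S) (only (S⊆W y∈S) v~y) y∈S)
    from : ∀ {S} → MaximalIndependentIn W S × v ∈ S → MaximalIndependentIn W S × u ∉ S
    from (max@(_ , indS , _) , v∈S) = max , λ u∈S → Independent⇒¬Edge indS v∈S u∈S edge

  -- Independence deficit

  DeficitAtLeast : ℕ → Subset n → Set
  DeficitAtLeast d W = ∀ S → S ⊆ W → Independent G S → ∣ S ∣ + d ≤ ∣ W ∣

  DeficitAtMost : ℕ → Subset n → Set
  DeficitAtMost d W = ∃[ S ] S ⊆ W × Independent G S × ∣ W ∣ ≤ ∣ S ∣ + d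

  deficitAtLeast-0 : ∀ W → DeficitAtLeast 0 W
  deficitAtLeast-0 W S S⊆W _ = ≤-trans (≤-reflexive (+-identityʳ ∣ S ∣)) (p⊆q⇒∣p∣≤∣q∣ S⊆W)

  IsIndependenceNumber⇒deficitAtLeast : ∀ {α} → IsIndependenceNumber G α → DeficitAtLeast (n ∸ α) ⊤
  IsIndependenceNumber⇒deficitAtLeast {α} ((S₀ , _ , ∣S₀∣≡α) , bound) S _ indS = begin
    ∣ S ∣ + (n ∸ α)  ≤⟨ +-monoˡ-≤ (n ∸ α) (bound S indS) ⟩
    α + (n ∸ α)      ≡⟨ m+[n∸m]≡n (subst (_≤ n) ∣S₀∣≡α (∣p∣≤n S₀)) ⟩
    n                ≡⟨ ∣⊤∣≡n n ⟨
    ∣ ⊤ {n} ∣        ∎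
    where open ≤-Reasoning

  deficit⇒IsIndependenceNumber : ∀ {d} → DeficitAtLeast d ⊤ → DeficitAtMost d ⊤ →
    IsIndependenceNumber G (n ∸ d)
  deficit⇒IsIndependenceNumber {d} atLeast (S , _ , indS , atMost) = (S , indS , ∣S∣≡) , bound
    where
    ∣S∣+d≡n : ∣ S ∣ + d ≡ n
    ∣S∣+d≡n = trans (≤-antisym (atLeast S ⊆⊤ indS) atMost) (∣⊤∣≡n n)
    ∣S∣≡ : ∣ S ∣ ≡ n ∸ d
    ∣S∣≡ = trans (sym (m+n∸n≡m ∣ S ∣ d)) (cong (_∸ d) ∣S∣+d≡n)
    bound : ∀ S′ → Independent G S′ → ∣ S′ ∣ ≤ n ∸ d
    bound S′ indS′ = m+n≤o⇒m≤o∸n ∣ S′ ∣ (subst (∣ S′ ∣ + d ≤_) (∣⊤∣≡n n) (atLeast S′ ⊆⊤ indS′))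

  module _ {W : Subset n} {u v : Fin n} (p : Pendant W u v) where
    open Pendant p

    pendant-split : ∀ {y} → y ∈ W → y ∈ W ∖N[ v ] ⊎ y ≡ u ⊎ y ≡ v
    pendant-split {y} y∈W with y ≟ᶠ v | edge? v y
    ... | yes y≡v | _       = inj₂ (inj₂ y≡v)
    ... | no _    | yes v~y = inj₂ (inj₁ (only y∈W v~y))
    ... | no y≢v  | no v≁y  = inj₁ (∈∖N⁺ y∈W y≢v v≁y)

    ∣∣≡2+∣∖N[leaf]∣ : ∣ W ∣ ≡ 2 + ∣ W ∖N[ v ] ∣
    ∣∣≡2+∣∖N[leaf]∣ = begin
      ∣ W ∣                              ≡⟨ cong ∣_∣ (⊆-antisym W⊆ ⊆W) ⟩
      ∣ W ∖N[ v ] ∪ (⁅ u ⁆ ∪ ⁅ v ⁆) ∣    ≡⟨ ∣p∪q∣≡∣p∣+∣q∣ (W ∖N[ v ]) (⁅ u ⁆ ∪ ⁅ v ⁆) disjoint ⟩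
      ∣ W ∖N[ v ] ∣ + ∣ ⁅ u ⁆ ∪ ⁅ v ⁆ ∣  ≡⟨ cong (∣ W ∖N[ v ] ∣ +_) (∣p∪⁅x⁆∣≡1+∣p∣ v∉⁅u⁆) ⟩
      ∣ W ∖N[ v ] ∣ + suc ∣ ⁅ u ⁆ ∣      ≡⟨ cong (λ k → ∣ W ∖N[ v ] ∣ + suc k) (∣⁅x⁆∣≡1 u) ⟩
      ∣ W ∖N[ v ] ∣ + 2                  ≡⟨ +-comm ∣ W ∖N[ v ] ∣ 2 ⟩
      2 + ∣ W ∖N[ v ] ∣                  ∎
      where
      open ≡-Reasoning
      v∉⁅u⁆ : v ∉ ⁅ u ⁆
      v∉⁅u⁆ v∈ = Edge-irrefl (subst (Edge G v) (sym (x∈⁅y⁆⇒x≡y u v∈)) edge)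
      W⊆ : W ⊆ W ∖N[ v ] ∪ (⁅ u ⁆ ∪ ⁅ v ⁆)
      W⊆ y∈W with pendant-split y∈W
      ... | inj₁ y∈W∖        = x∈p∪q⁺ (inj₁ y∈W∖)
      ... | inj₂ (inj₁ refl) = x∈p∪q⁺ (inj₂ (x∈p∪q⁺ (inj₁ (x∈⁅x⁆ u))))
      ... | inj₂ (inj₂ refl) = x∈p∪q⁺ (inj₂ (x∈p∪q⁺ (inj₂ (x∈⁅x⁆ v))))
      ⊆W : W ∖N[ v ] ∪ (⁅ u ⁆ ∪ ⁅ v ⁆) ⊆ W
      ⊆W {y} y∈ with x∈p∪q⁻ (W ∖N[ v ]) _ y∈
      ... | inj₁ y∈W∖ = ∖N-⊆ y∈W∖
      ... | inj₂ y∈uv with x∈p∪q⁻ ⁅ u ⁆ ⁅ v ⁆ y∈uv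
      ...   | inj₁ y∈⁅u⁆ = subst (_∈ W) (sym (x∈⁅y⁆⇒x≡y u y∈⁅u⁆)) support∈
      ...   | inj₂ y∈⁅v⁆ = subst (_∈ W) (sym (x∈⁅y⁆⇒x≡y v y∈⁅v⁆)) leaf∈
      disjoint : ∀ {y} → y ∈ W ∖N[ v ] → y ∉ ⁅ u ⁆ ∪ ⁅ v ⁆
      disjoint y∈ y∈uv with ∈∖N⁻ y∈ | x∈p∪q⁻ ⁅ u ⁆ ⁅ v ⁆ y∈uv
      ... | _ , _ , v≁y | inj₁ y∈⁅u⁆ = v≁y (subst (Edge G v) (sym (x∈⁅y⁆⇒x≡y u y∈⁅u⁆)) edge)
      ... | _ , y≢v , _ | inj₂ y∈⁅v⁆ = y≢v (x∈⁅y⁆⇒x≡y v y∈⁅v⁆)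

    ∪⁅leaf⁆-independent : ∀ {S} → S ⊆ W ∖N[ v ] → Independent G S →
      S ∪ ⁅ v ⁆ ⊆ W × Independent G (S ∪ ⁅ v ⁆) × ∣ S ∪ ⁅ v ⁆ ∣ ≡ suc ∣ S ∣
    ∪⁅leaf⁆-independent S⊆ indS =
      let (⊆W , ind) = ∪⁅⁆-independent leaf∈ S⊆ indS in ⊆W , ind , ∣p∪⁅x⁆∣≡1+∣p∣ (x∉∖N[x] ∘ S⊆)

    deficitAtLeast-pendant⁻ : ∀ {d} → DeficitAtLeast d W → DeficitAtLeast (d ∸ 1) (W ∖N[ v ])
    deficitAtLeast-pendant⁻ {d} deficit S S⊆ indS =
      let (⊆W , ind , ∣S∪v∣) = ∪⁅leaf⁆-independent S⊆ indS in
      m≤n∧m+o≤p+n⇒m+[o∸p]≤n (suc d) 2 (p⊆q⇒∣p∣≤∣q∣ S⊆) (begin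
        ∣ S ∣ + suc d         ≡⟨ +-suc ∣ S ∣ d ⟩
        suc ∣ S ∣ + d         ≡⟨ cong (_+ d) ∣S∪v∣ ⟨
        ∣ S ∪ ⁅ v ⁆ ∣ + d     ≤⟨ deficit (S ∪ ⁅ v ⁆) ⊆W ind ⟩
        ∣ W ∣                 ≡⟨ ∣∣≡2+∣∖N[leaf]∣ ⟩
        2 + ∣ W ∖N[ v ] ∣     ∎)
      where open ≤-Reasoning

    deficitAtMost-pendant : ∀ {d} → DeficitAtMost d (W ∖N[ v ]) → DeficitAtMost (suc d) W
    deficitAtMost-pendant {d} (S , S⊆ , indS , bound) =
      let (⊆W , ind , ∣S∪v∣) = ∪⁅leaf⁆-independent S⊆ indS in
      S ∪ ⁅ v ⁆ , ⊆W , ind , (begin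
        ∣ W ∣                  ≡⟨ ∣∣≡2+∣∖N[leaf]∣ ⟩
        2 + ∣ W ∖N[ v ] ∣      ≤⟨ +-monoʳ-≤ 2 bound ⟩
        2 + (∣ S ∣ + d)        ≡⟨ cong suc (+-suc ∣ S ∣ d) ⟨
        suc ∣ S ∣ + suc d      ≡⟨ cong (_+ suc d) ∣S∪v∣ ⟨
        ∣ S ∪ ⁅ v ⁆ ∣ + suc d  ∎)
      where open ≤-Reasoning

    deficitAtLeast-pendant⁺ : ∀ {d} → DeficitAtLeast d (W ∖N[ v ]) → DeficitAtLeast (suc d) W
    deficitAtLeast-pendant⁺ {d} deficit S S⊆W indS = begin
      ∣ S ∣ + suc d                   ≤⟨ +-monoˡ-≤ (suc d) ∣S∣≤ ⟩
      suc ∣ S ∩ W ∖N[ v ] ∣ + suc d   ≡⟨ cong suc (+-suc _ d) ⟩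
      2 + (∣ S ∩ W ∖N[ v ] ∣ + d)     ≤⟨ +-monoʳ-≤ 2 (deficit (S ∩ W ∖N[ v ]) (p∩q⊆q S _)
                                           (Independent-⊆ (p∩q⊆p S _) indS)) ⟩
      2 + ∣ W ∖N[ v ] ∣               ≡⟨ ∣∣≡2+∣∖N[leaf]∣ ⟨
      ∣ W ∣                           ∎
      where
      open ≤-Reasoning
      cover : ∀ t → (∀ {y} → y ∈ S → y ≡ u ⊎ y ≡ v → y ≡ t) → S ⊆ S ∩ W ∖N[ v ] ∪ ⁅ t ⁆
      cover t only-t y∈S with pendant-split (S⊆W y∈S)
      ... | inj₁ y∈W∖ = x∈p∪q⁺ (inj₁ (x∈p∩q⁺ (y∈S , y∈W∖)))
      ... | inj₂ u/v  = x∈p∪q⁺ (inj₂ (subst (_∈ ⁅ t ⁆) (sym (only-t y∈S u/v)) (x∈⁅x⁆ t)))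
      -- an independent set contains at most one end of the edge uv
      at-most-one : ∃[ t ] S ⊆ S ∩ W ∖N[ v ] ∪ ⁅ t ⁆
      at-most-one with u ∈? S
      ... | yes u∈S = u , cover u λ { _   (inj₁ y≡u)  → y≡u
                                    ; v∈S (inj₂ refl) → ⊥-elim (Independent⇒¬Edge indS v∈S u∈S edge) }
      ... | no u∉S  = v , cover v λ { u∈S (inj₁ refl) → ⊥-elim (u∉S u∈S)
                                    ; _   (inj₂ y≡v)  → y≡v }
      ∣S∣≤ : ∣ S ∣ ≤ suc ∣ S ∩ W ∖N[ v ] ∣
      ∣S∣≤ = let (t , S⊆) = at-most-one in
        subst (∣ S ∣ ≤_) (trans (cong (∣ S ∩ W ∖N[ v ] ∣ +_) (∣⁅x⁆∣≡1 t)) (+-comm ∣ S ∩ W ∖N[ v ] ∣ 1))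
          (p⊆q∪r⇒∣p∣≤∣q∣+∣r∣ (S ∩ W ∖N[ v ]) ⁅ t ⁆ S⊆)

  -- Twigs and the lower bound

  -- the configuration at the end of a longest path in a forest
  record Twig (W : Subset n) : Set where
    field
      support leaf exit : Fin n
      pendant : Pendant W support leaf
      leaves  : ∀ {z y} → z ∈ W → Edge G support z → z ≢ exit → y ∈ W → Edge G z y → y ≡ support

  module _ {W : Subset n} (t : Twig W) where
    open Twig t

    twigLeaves : Subset n
    twigLeaves = ⟦ (_∈? W) ∩? edge? support ∩? ∁? (_≟ᶠ exit) ⟧

    ∈twigLeaves⁻ : ∀ {z} → z ∈ twigLeaves → z ∈ W × Edge G support z × z ≢ exit
    ∈twigLeaves⁻ = ∈⟦⟧⁻ ((_∈? W) ∩? edge? support ∩? ∁? (_≟ᶠ exit))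

    ∈twigLeaves⁺ : ∀ {z} → z ∈ W → Edge G support z → z ≢ exit → z ∈ twigLeaves
    ∈twigLeaves⁺ z∈W u~z z≢exit = ∈⟦⟧⁺ ((_∈? W) ∩? edge? support ∩? ∁? (_≟ᶠ exit)) (z∈W , u~z , z≢exit)

    twigLeaves-only : ∀ {z y} → z ∈ twigLeaves → y ∈ W → Edge G z y → y ≡ support
    twigLeaves-only z∈L = let (z∈W , u~z , z≢exit) = ∈twigLeaves⁻ z∈L in leaves z∈W u~z z≢exit

    ∣∣≤2+∣∖N[support]∣+∣twigLeaves∣ : ∣ W ∣ ≤ 2 + ∣ W ∖N[ support ] ∣ + ∣ twigLeaves ∣
    ∣∣≤2+∣∖N[support]∣+∣twigLeaves∣ = begin
      ∣ W ∣                    ≤⟨ p⊆q∪r⇒∣p∣≤∣q∣+∣r∣ ((⁅ support ⁆ ∪ ⁅ exit ⁆) ∪ N) twigLeaves W⊆ ⟩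
      ∣ (⁅ support ⁆ ∪ ⁅ exit ⁆) ∪ N ∣ + ∣ twigLeaves ∣
                               ≤⟨ +-monoˡ-≤ ∣ twigLeaves ∣ (∣p∪q∣≤∣p∣+∣q∣ (⁅ support ⁆ ∪ ⁅ exit ⁆) N) ⟩
      ∣ ⁅ support ⁆ ∪ ⁅ exit ⁆ ∣ + ∣ N ∣ + ∣ twigLeaves ∣
                               ≤⟨ +-monoˡ-≤ ∣ twigLeaves ∣ (+-monoˡ-≤ ∣ N ∣ (∣⁅x⁆∪⁅y⁆∣≤2 support exit)) ⟩
      2 + ∣ N ∣ + ∣ twigLeaves ∣ ∎
      where
      open ≤-Reasoning
      N = W ∖N[ support ]
      W⊆ : W ⊆ ((⁅ support ⁆ ∪ ⁅ exit ⁆) ∪ N) ∪ twigLeaves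
      W⊆ {y} y∈W with y ≟ᶠ support | y ≟ᶠ exit | edge? support y
      ... | yes refl | _        | _       = x∈p∪q⁺ (inj₁ (x∈p∪q⁺ (inj₁ (x∈p∪q⁺ (inj₁ (x∈⁅x⁆ y))))))
      ... | no _     | yes refl | _       = x∈p∪q⁺ (inj₁ (x∈p∪q⁺ (inj₁ (x∈p∪q⁺ (inj₂ (x∈⁅x⁆ y))))))
      ... | no _     | no y≢e   | yes u~y = x∈p∪q⁺ (inj₂ (∈twigLeaves⁺ y∈W u~y y≢e))
      ... | no y≢u   | no _     | no u≁y  = x∈p∪q⁺ (inj₁ (x∈p∪q⁺ (inj₂ (∈∖N⁺ y∈W y≢u u≁y))))

    ∪twigLeaves-independent : ∀ {S} → S ⊆ W ∖N[ support ] → Independent G S →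
      S ∪ twigLeaves ⊆ W × Independent G (S ∪ twigLeaves) × ∣ S ∪ twigLeaves ∣ ≡ ∣ S ∣ + ∣ twigLeaves ∣
    ∪twigLeaves-independent {S} S⊆ indS =
      ⊆W , Independent-∪ indS indL cross , ∣p∪q∣≡∣p∣+∣q∣ S twigLeaves disjoint
      where
      ⊆W : S ∪ twigLeaves ⊆ W
      ⊆W y∈ with x∈p∪q⁻ S twigLeaves y∈
      ... | inj₁ y∈S = ∖N-⊆ (S⊆ y∈S)
      ... | inj₂ y∈L = proj₁ (∈twigLeaves⁻ y∈L)
      indL : Independent G twigLeaves
      indL z z′ z∈L z′∈L = Bool.¬-not λ z~z′ → let (z′∈W , u~z′ , _) = ∈twigLeaves⁻ z′∈L in
        Edge-irrefl (subst (Edge G support) (twigLeaves-only z∈L z′∈W z~z′) u~z′)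
      cross : ∀ {x z} → x ∈ S → z ∈ twigLeaves → ¬ Edge G x z
      cross x∈S z∈L x~z = let (x∈W , x≢u , _) = ∈∖N⁻ (S⊆ x∈S) in
        x≢u (twigLeaves-only z∈L x∈W (Edge-sym x~z))
      disjoint : ∀ {x} → x ∈ S → x ∉ twigLeaves
      disjoint x∈S x∈L = proj₂ (proj₂ (∈∖N⁻ (S⊆ x∈S))) (proj₁ (proj₂ (∈twigLeaves⁻ x∈L)))

    deficitAtLeast-twig : ∀ {d} → DeficitAtLeast d W → DeficitAtLeast (d ∸ 2) (W ∖N[ support ])
    deficitAtLeast-twig {d} deficit S S⊆ indS =
      let (⊆W , ind , ∣S∪L∣) = ∪twigLeaves-independent S⊆ indS in
      m≤n∧m+o≤p+n⇒m+[o∸p]≤n d 2 (p⊆q⇒∣p∣≤∣q∣ S⊆) (+-cancelʳ-≤ ∣ twigLeaves ∣ _ _ (begin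
        ∣ S ∣ + d + ∣ twigLeaves ∣                 ≡⟨ xy∙z≈xz∙y (∣ S ∣) d (∣ twigLeaves ∣) ⟩
        ∣ S ∣ + ∣ twigLeaves ∣ + d                 ≡⟨ cong (_+ d) ∣S∪L∣ ⟨
        ∣ S ∪ twigLeaves ∣ + d                     ≤⟨ deficit (S ∪ twigLeaves) ⊆W ind ⟩
        ∣ W ∣                                      ≤⟨ ∣∣≤2+∣∖N[support]∣+∣twigLeaves∣ ⟩
        2 + ∣ W ∖N[ support ] ∣ + ∣ twigLeaves ∣   ∎))
      where open ≤-Reasoning

  module _ (acyclic : Acyclic G) {W : Subset n} where

    PathIn : List (Fin n) → Set
    PathIn xs = All (_∈ W) xs × Linked (Edge G) xs × Unique xs

    no-chord : ∀ {a b c xs} → Linked (Edge G) (a ∷ b ∷ xs) → Unique (a ∷ b ∷ xs) → c ∈ˡ xs → ¬ Edge G c a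
    no-chord {a} {b} {c} linked uniq c∈xs c~a with ∈-∃++ c∈xs
    ... | pre , _ , refl = acyclic
      (a , c , b ∷ pre , s≤s z≤n , Linked-∷ʳ⁻ (a ∷ b ∷ pre) linked , Unique-∷ʳ⁻ (a ∷ b ∷ pre) uniq , c~a)

    extend : ∀ {x z} p → PathIn (x ∷ p) → z ∈ W → Edge G z x → z ≢ headOr x p → PathIn (z ∷ x ∷ p)
    extend {x} {z} p (x∈W ∷ p⊆W , linked , uniq) z∈W z~x z≢next =
      z∈W ∷ x∈W ∷ p⊆W , z~x ∷ linked , ((λ { refl → Edge-irrefl z~x }) ∷ z∉p p linked uniq z≢next) ∷ uniq
      where
      z∉p : ∀ p → Linked (Edge G) (x ∷ p) → Unique (x ∷ p) → z ≢ headOr x p → All (z ≢_) p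
      z∉p []      _      _    _   = []
      z∉p (y ∷ r) linked uniq z≢y =
        z≢y ∷ All.tabulate λ w∈r z≡w → no-chord linked uniq (subst (_∈ˡ r) (sym z≡w) w∈r) z~x

    -- longest path argument: while x, y is not the end of a twig, lengthen the path, either
    -- at x or by replacing x with a non-leaf neighbour z of y and a further neighbour of z
    grow : ∀ fuel {x y r} → PathIn (x ∷ y ∷ r) → n < fuel + length (x ∷ y ∷ r) → Twig W
    grow zero (_ , _ , uniq) n< = contradiction (Unique⇒length≤ uniq) (<⇒≱ n<)
    grow (suc fuel) {x} {y} {r} path@(x∈W ∷ y∈W ∷ _ , x~y ∷ _ , _ ∷ _) n<
      with any? (λ z → z ∈? W ×-dec edge? x z ×-dec ¬? (z ≟ᶠ y))
    ... | yes (z , z∈W , x~z , z≢y) =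
      grow fuel (extend (y ∷ r) path z∈W (Edge-sym x~z) z≢y) n<′
      where n<′ = subst (n <_) (sym (+-suc fuel (length (x ∷ y ∷ r)))) n<
    ... | no x-leaf with any? (λ z → z ∈? W ×-dec edge? y z ×-dec ¬? (z ≟ᶠ headOr y r) ×-dec
                                   any? (λ t → t ∈? W ×-dec edge? z t ×-dec ¬? (t ≟ᶠ y)))
    ...   | yes (z , z∈W , y~z , z≢w , t , t∈W , z~t , t≢y) =
      grow fuel (extend (y ∷ r) (extend r (tail path) z∈W (Edge-sym y~z) z≢w) t∈W (Edge-sym z~t) t≢y) n<′
      where
      tail : PathIn (x ∷ y ∷ r) → PathIn (y ∷ r)
      tail (_ ∷ all , _ ∷ linked , _ ∷ uniq) = all , linked , uniq
      n<′ = subst (n <_) (sym (+-suc fuel (length (x ∷ y ∷ r)))) n<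
    ...   | no y-support = record
      { support = y ; leaf = x ; exit = headOr y r
      ; pendant = record
        { support∈ = y∈W ; leaf∈ = x∈W ; edge = x~y
        ; only = λ {t} t∈W x~t → decidable-stable (t ≟ᶠ y) λ t≢y → x-leaf (t , t∈W , x~t , t≢y) }
      ; leaves = λ {z} {t} z∈W y~z z≢w t∈W z~t → decidable-stable (t ≟ᶠ y) λ t≢y →
          y-support (z , z∈W , y~z , z≢w , t , t∈W , z~t , t≢y) }

    twig : ∀ {x y} → x ∈ W → y ∈ W → Edge G x y → Twig W
    twig x∈W y∈W x~y = grow n (x∈W ∷ y∈W ∷ [] , x~y ∷ [-] , ((λ { refl → Edge-irrefl x~y }) ∷ []) ∷ [] ∷ [])
      (m<m+n n (s≤s z≤n))

  hasEdgeIn? : ∀ W → Dec (∃[ x ] ∃[ y ] x ∈ W × y ∈ W × Edge G x y)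
  hasEdgeIn? W = any? λ x → any? λ y → x ∈? W ×-dec y ∈? W ×-dec edge? x y

  misIn-lower-bound : Acyclic G → ∀ {W d} → DeficitAtLeast d W → fib (d + 2) ≤ misIn W
  misIn-lower-bound acyclic {W} = go W (<-wellFounded ∣ W ∣)
    where
    go : ∀ W {d} → Acc _<_ ∣ W ∣ → DeficitAtLeast d W → fib (d + 2) ≤ misIn W
    go W {d} (acc smaller) deficit with hasEdgeIn? W
    ... | no no-edge = subst (λ d → fib (d + 2) ≤ misIn W) (sym d≡0)
                        (≤-reflexive (sym (misIn-edgeless edgeless)))
      where
      edgeless : EdgelessIn W
      edgeless {x} {y} x∈ y∈ x~y = no-edge (x , y , x∈ , y∈ , x~y)
      d≡0 : d ≡ 0
      d≡0 = n≤0⇒n≡0 (+-cancelˡ-≤ ∣ W ∣ d 0 (subst (∣ W ∣ + d ≤_) (sym (+-identityʳ ∣ W ∣))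
              (deficit W (λ x∈ → x∈) (Edgeless⇒Independent edgeless))))
    ... | yes (_ , _ , x∈ , y∈ , x~y) = begin
      fib (d + 2)                            ≤⟨ fib-split d ⟩
      fib (d ∸ 2 + 2) + fib (d ∸ 1 + 2)      ≤⟨ +-mono-≤
        (go (W ∖N[ u ]) (smaller (∣∖N∣<∣∣ support∈)) (deficitAtLeast-twig t deficit))
        (go (W ∖N[ v ]) (smaller (∣∖N∣<∣∣ leaf∈)) (deficitAtLeast-pendant⁻ pendant deficit)) ⟩
      misIn (W ∖N[ u ]) + misIn (W ∖N[ v ])  ≡⟨ misIn-pendant pendant ⟨
      misIn W                                ∎
      where
      open ≤-Reasoning
      t = twig acyclic x∈ y∈ x~y
      open Twig t renaming (support to u; leaf to v)
      open Pendant pendant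

-- Trees given by a parent function

module _ {G : Graph n} where

  _++ʷ_ : ∀ {a b c} → Walk G a b → Walk G b c → Walk G a c
  []       ++ʷ w′ = w′
  (e ∷ w) ++ʷ w′ = e ∷ (w ++ʷ w′)

  reverseʷ : ∀ {a b} → Walk G a b → Walk G b a
  reverseʷ []      = []
  reverseʷ (e ∷ w) = reverseʷ w ++ʷ (Induced.Edge-sym G e ∷ [])

  connected-via : (r : Fin n) → (∀ a → Walk G a r) → Connected G
  connected-via r to-r a b = to-r a ++ʷ reverseʷ (to-r b)

does-true : ∀ {P : Set} (P? : Dec P) → does P? ≡ true → P
does-true (yes p) _ = p

module _ {n : ℕ} (parent : ℕ → ℕ) where

  ParentOf : Fin n → Fin n → Set
  ParentOf a b = 0 < toℕ b × toℕ a ≡ parent (toℕ b)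

  parentOf? : ∀ (a b : Fin n) → Dec (ParentOf a b)
  parentOf? a b = 0 <? toℕ b ×-dec toℕ a ℕ.≟ parent (toℕ b)

module _ {n : ℕ} {parent : ℕ → ℕ} (parent< : ∀ {x} → 0 < x → parent x < x) where

  parentGraph : Graph n
  parentGraph = record
    { adj    = λ a b → does (parentOf? parent a b ⊎-dec parentOf? parent b a)
    ; symm   = λ a b → does-⇔ (mk⇔ swap swap)
                 (parentOf? parent a b ⊎-dec parentOf? parent b a) (parentOf? parent b a ⊎-dec parentOf? parent a b)
    ; irrefl = λ a → dec-false (parentOf? parent a a ⊎-dec parentOf? parent a a) λ where
        (inj₁ (pos , a≡)) → <-irrefl (sym a≡) (parent< pos)
        (inj₂ (pos , a≡)) → <-irrefl (sym a≡) (parent< pos)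
    }

  Edge⇒ParentOf : ∀ {a b} → Edge parentGraph a b → ParentOf parent a b ⊎ ParentOf parent b a
  Edge⇒ParentOf {a} {b} = does-true (parentOf? parent a b ⊎-dec parentOf? parent b a)

  ParentOf⇒Edge : ∀ {a b} → ParentOf parent a b ⊎ ParentOf parent b a → Edge parentGraph a b
  ParentOf⇒Edge {a} {b} = dec-true (parentOf? parent a b ⊎-dec parentOf? parent b a)

  ParentOf⇒< : ∀ {a b : Fin n} → ParentOf parent a b → toℕ a < toℕ b
  ParentOf⇒< (pos , a≡) = subst (_< _) (sym a≡) (parent< pos)

  parentGraph-connected : 0 < n → Connected parentGraph
  parentGraph-connected 0<n = connected-via root λ a → to-root a (<-wellFounded (toℕ a))
    where
    root = fromℕ< 0<n
    to-root : ∀ a → Acc _<_ (toℕ a) → Walk parentGraph a root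
    to-root a (acc smaller) with 0 <? toℕ a
    ... | no ¬pos = subst (λ b → Walk parentGraph b root)
                      (toℕ-injective (trans (toℕ-fromℕ< 0<n) (sym (n≤0⇒n≡0 (≮⇒≥ ¬pos))))) []
    ... | yes pos = ParentOf⇒Edge (inj₂ (pos , toℕ-fromℕ< p<n)) ∷ to-root (fromℕ< p<n)
                      (smaller (subst (_< toℕ a) (sym (toℕ-fromℕ< p<n)) (parent< pos)))
      where p<n = <-trans (parent< pos) (toℕ<n a)

  -- non-backtracking walks from a to z, with second vertex b and penultimate vertex y
  data NBWalk : (a b y z : Fin n) → Set where
    edge : ∀ {a b} → Edge parentGraph a b → NBWalk a b a b
    step : ∀ {a b c y z} → Edge parentGraph a b → a ≢ c → NBWalk b c y z → NBWalk a b y z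

  private
    first-edge : ∀ {a b y z} → NBWalk a b y z → Edge parentGraph a b
    first-edge (edge e)     = e
    first-edge (step e _ _) = e

    last-edge : ∀ {a b y z} → NBWalk a b y z → Edge parentGraph y z
    last-edge (edge e)        = e
    last-edge (step _ _ walk) = last-edge walk

    rank-cmp : ∀ {a b} → Edge parentGraph a b → toℕ a < toℕ b ⊎ toℕ b < toℕ a
    rank-cmp = Sum.map ParentOf⇒< ParentOf⇒< ∘ Edge⇒ParentOf

    lower-unique : ∀ {a b c} → Edge parentGraph a b → Edge parentGraph c b →
      toℕ a < toℕ b → toℕ c < toℕ b → a ≡ c
    lower-unique a~b c~b a<b c<b = toℕ-injective (trans (parent-of a~b a<b) (sym (parent-of c~b c<b)))
      where
      parent-of : ∀ {a b} → Edge parentGraph a b → toℕ a < toℕ b → toℕ a ≡ parent (toℕ b)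
      parent-of a~b a<b with Edge⇒ParentOf a~b
      ... | inj₁ (_ , a≡) = a≡
      ... | inj₂ b-parent = contradiction (ParentOf⇒< b-parent) (<⇒≯ a<b)

  -- after climbing to b the walk cannot descend: its next vertex would be a second parent of b
  rising : ∀ {a b y z} → NBWalk a b y z → toℕ a < toℕ b → toℕ a < toℕ z × toℕ y < toℕ z
  rising (edge _) a<b = a<b , a<b
  rising (step {b = b} {c} a~b a≢c walk) a<b with rank-cmp (first-edge walk)
  ... | inj₁ b<c = let (b<z , y<z) = rising walk b<c in <-trans a<b b<z , y<z
  ... | inj₂ c<b =
    contradiction (lower-unique a~b (Induced.Edge-sym parentGraph {b} {c} (first-edge walk)) a<b c<b) a≢c

  falling : ∀ {a b y z} → NBWalk a b y z → toℕ z < toℕ y → toℕ z < toℕ a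
  falling (edge _) z<y = z<y
  falling walk@(step a~b _ rest) z<y with rank-cmp a~b
  ... | inj₁ a<b = contradiction (proj₂ (rising walk a<b)) (<⇒≯ z<y)
  ... | inj₂ b<a = <-trans (falling rest z<y) b<a

  -- the vertex of maximal rank on a closed walk would have two lower neighbours
  no-closed-NBWalk : ∀ {a b y} → NBWalk a b y a → b ≢ y → ⊥
  no-closed-NBWalk {a} {b} walk b≢y with rank-cmp (first-edge walk) | rank-cmp (last-edge walk)
  ... | inj₁ a<b | _        = <-irrefl refl (proj₁ (rising walk a<b))
  ... | inj₂ b<a | inj₁ y<a =
    b≢y (lower-unique (Induced.Edge-sym parentGraph {a} {b} (first-edge walk)) (last-edge walk) b<a y<a)
  ... | inj₂ _   | inj₂ a<y = <-irrefl refl (falling walk a<y)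

  private
    second-≢ : ∀ {a b w : Fin n} l → All (a ≢_) (b ∷ l ∷ʳ w) → a ≢ headOr w l
    second-≢ []      (_ ∷ a≢w ∷ []) = a≢w
    second-≢ (_ ∷ _) (_ ∷ a≢c ∷ _)  = a≢c

    cycle-NBWalk : ∀ {v₀ w a} l → Linked (Edge parentGraph) (a ∷ l ∷ʳ w) → Unique (a ∷ l ∷ʳ w) →
      All (_≢ v₀) (a ∷ l) → Edge parentGraph w v₀ → NBWalk a (headOr w l) w v₀
    cycle-NBWalk []      (a~w ∷ _)      _           (a≢v₀ ∷ []) w~v₀ = step a~w a≢v₀ (edge w~v₀)
    cycle-NBWalk (_ ∷ l) (a~b ∷ linked) (a∉ ∷ uniq) (_ ∷ ≢v₀)   w~v₀ =
      step a~b (second-≢ l a∉) (cycle-NBWalk l linked uniq ≢v₀ w~v₀)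

  parentGraph-acyclic : Acyclic parentGraph
  parentGraph-acyclic (_ , _ , [] , () , _)
  parentGraph-acyclic (v₀ , w , m₁ ∷ mid , _ , v₀~m₁ ∷ linked , v₀∉ ∷ m₁∉ ∷ uniq , w~v₀) =
    no-closed-NBWalk
      (step v₀~m₁ (second-≢ mid v₀∉)
        (cycle-NBWalk mid linked (m₁∉ ∷ uniq) (All.map ≢-sym (Allₚ.++⁻ˡ (m₁ ∷ mid) v₀∉)) w~v₀))
      (proj₂ (Allₚ.∷ʳ⁻ m₁∉))

-- Combs

double : ℕ → ℕ
double zero    = zero
double (suc j) = suc (suc (double j))

double≢1+double : ∀ i j → double i ≢ suc (double j)
double≢1+double (suc i) (suc j) eq = double≢1+double i j (suc-injective (suc-injective eq))

double-mono-≤ : ∀ {i j} → i ≤ j → double i ≤ double j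
double-mono-≤ z≤n       = z≤n
double-mono-≤ (s≤s i≤j) = s≤s (s≤s (double-mono-≤ i≤j))

double≡+ : ∀ j → double j ≡ j + j
double≡+ zero    = refl
double≡+ (suc j) = cong suc (trans (cong suc (double≡+ j)) (sym (+-suc j j)))

-- the spine 0, 2, …, 2ℓ is a path (2j + 2 hangs at 2j), the leaf 2j + 1 hangs at 2j,
-- and every vertex beyond 2ℓ hangs at 2ℓ
combParent : ℕ → ℕ → ℕ
combParent (suc ℓ) (suc (suc (suc x))) = 2 + combParent ℓ (suc x)
combParent _       _                   = 0

combParent< : ∀ ℓ {x} → 0 < x → combParent ℓ x < x
combParent< zero    {suc x}                   _ = s≤s z≤n
combParent< (suc ℓ) {suc zero}                _ = s≤s z≤n
combParent< (suc ℓ) {suc (suc zero)}          _ = s≤s z≤n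
combParent< (suc ℓ) {suc (suc (suc x))}       _ = s≤s (s≤s (combParent< ℓ {suc x} (s≤s z≤n)))

combParent-spine : ∀ ℓ x → ∃[ i ] i ≤ ℓ × combParent ℓ x ≡ double i
combParent-spine zero    _                   = 0 , z≤n , refl
combParent-spine (suc ℓ) zero                = 0 , z≤n , refl
combParent-spine (suc ℓ) (suc zero)          = 0 , z≤n , refl
combParent-spine (suc ℓ) (suc (suc zero))    = 0 , z≤n , refl
combParent-spine (suc ℓ) (suc (suc (suc x))) =
  let (i , i≤ℓ , eq) = combParent-spine ℓ (suc x) in suc i , s≤s i≤ℓ , cong (2 +_) eq

combParent-leaf : ∀ {ℓ j} → j ≤ ℓ → combParent ℓ (suc (double j)) ≡ double j
combParent-leaf {zero}  z≤n       = refl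
combParent-leaf {suc ℓ} z≤n       = refl
combParent-leaf         (s≤s j≤ℓ) = cong (2 +_) (combParent-leaf j≤ℓ)

combParent-next : ∀ {ℓ j} → j < ℓ → combParent ℓ (2 + double j) ≡ double j
combParent-next {suc ℓ} {zero}  _         = refl
combParent-next {suc ℓ} {suc j} (s≤s j<ℓ) = cong (2 +_) (combParent-next j<ℓ)

combParent-children : ∀ {ℓ j x} → j < ℓ → 0 < x → combParent ℓ x ≡ double j →
  x ≡ suc (double j) ⊎ x ≡ 2 + double j
combParent-children {suc ℓ} {zero}  {1}                   _         _ _  = inj₁ refl
combParent-children {suc ℓ} {zero}  {2}                   _         _ _  = inj₂ refl
combParent-children {suc ℓ} {suc j} {suc (suc (suc x))}   (s≤s j<ℓ) _ eq =
  Sum.map (cong (2 +_)) (cong (2 +_))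
    (combParent-children j<ℓ (s≤s z≤n) (suc-injective (suc-injective eq)))

module _ {n : ℕ} (ℓ : ℕ) where

  comb : Graph n
  comb = parentGraph (combParent< ℓ)

  Tail : ℕ → Subset n
  Tail t = ⟦ (λ x → t ≤? toℕ x) ⟧

  ∈Tail⁺ : ∀ {t x} → t ≤ toℕ x → x ∈ Tail t
  ∈Tail⁺ {t} = ∈⟦⟧⁺ (λ x → t ≤? toℕ x)

  ∈Tail⁻ : ∀ {t x} → x ∈ Tail t → t ≤ toℕ x
  ∈Tail⁻ {t} = ∈⟦⟧⁻ (λ x → t ≤? toℕ x)

  Tail-anti : ∀ {s t} → s ≤ t → Tail t ⊆ Tail s
  Tail-anti s≤t x∈ = ∈Tail⁺ (≤-trans s≤t (∈Tail⁻ x∈))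

  Tail-0 : Tail 0 ≡ ⊤
  Tail-0 = ⊆-antisym ⊆⊤ λ _ → ∈Tail⁺ z≤n

  parent-on-spine : ∀ {a b : Fin n} → ParentOf (combParent ℓ) a b → ∃[ i ] i ≤ ℓ × toℕ a ≡ double i
  parent-on-spine {b = b} (_ , a≡) = let (i , i≤ℓ , eq) = combParent-spine ℓ (toℕ b) in i , i≤ℓ , trans a≡ eq

  beyond-spine : ∀ {a b : Fin n} → a ∈ Tail (suc (double ℓ)) → ¬ ParentOf (combParent ℓ) a b
  beyond-spine a∈ a-parent = let (i , i≤ℓ , a≡) = parent-on-spine a-parent in
    <⇒≱ (∈Tail⁻ a∈) (subst (_≤ double ℓ) (sym a≡) (double-mono-≤ i≤ℓ))

  Tail-edgeless : ∀ {t} → suc (double ℓ) ≤ t → Induced.EdgelessIn comb (Tail t)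
  Tail-edgeless 2ℓ<t a∈ b∈ a~b with Edge⇒ParentOf (combParent< ℓ) a~b
  ... | inj₁ a-parent = beyond-spine (Tail-anti 2ℓ<t a∈) a-parent
  ... | inj₂ b-parent = beyond-spine (Tail-anti 2ℓ<t b∈) b-parent

  module _ (room : 2 + double ℓ ≤ n) where
    open Induced comb

    private
      1+double<n : ∀ {j} → j ≤ ℓ → suc (double j) < n
      1+double<n j≤ℓ = ≤-trans (s≤s (s≤s (double-mono-≤ j≤ℓ))) room

    spine leaf : ∀ {j} → j ≤ ℓ → Fin n
    spine j≤ℓ = fromℕ< (<-trans (n<1+n _) (1+double<n j≤ℓ))
    leaf  j≤ℓ = fromℕ< (1+double<n j≤ℓ)

    module _ {j : ℕ} (j≤ℓ : j ≤ ℓ) where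

      toℕ-spine : toℕ (spine j≤ℓ) ≡ double j
      toℕ-spine = toℕ-fromℕ< _

      toℕ-leaf : toℕ (leaf j≤ℓ) ≡ suc (double j)
      toℕ-leaf = toℕ-fromℕ< _

      leaf-edge : ∀ {y} → toℕ y ≡ double j → Edge comb (leaf j≤ℓ) y
      leaf-edge y≡ = ParentOf⇒Edge (combParent< ℓ) (inj₂ (subst (0 <_) (sym toℕ-leaf) (s≤s z≤n) ,
        trans y≡ (sym (trans (cong (combParent ℓ) toℕ-leaf) (combParent-leaf j≤ℓ)))))

      leaf-neighbour : ∀ {y} → Edge comb (leaf j≤ℓ) y → toℕ y ≡ double j
      leaf-neighbour leaf~y with Edge⇒ParentOf (combParent< ℓ) leaf~y
      ... | inj₁ leaf-parent = let (i , _ , leaf≡) = parent-on-spine leaf-parent in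
        ⊥-elim (double≢1+double i j (trans (sym leaf≡) toℕ-leaf))
      ... | inj₂ (_ , y≡) = trans y≡ (trans (cong (combParent ℓ) toℕ-leaf) (combParent-leaf j≤ℓ))

      pendant : Pendant (Tail (double j)) (spine j≤ℓ) (leaf j≤ℓ)
      pendant = record
        { support∈ = ∈Tail⁺ (≤-reflexive (sym toℕ-spine))
        ; leaf∈    = ∈Tail⁺ (subst (double j ≤_) (sym toℕ-leaf) (n≤1+n _))
        ; edge     = leaf-edge toℕ-spine
        ; only     = λ _ leaf~y → toℕ-injective (trans (leaf-neighbour leaf~y) (sym toℕ-spine))
        }

      ∖N[leaf] : ∀ {t} → double j ≤ t → t ≤ suc (double j) → Tail t ∖N[ leaf j≤ℓ ] ≡ Tail (2 + double j)
      ∖N[leaf] {t} 2j≤t t≤2j+1 = ⊆-antisym ⊆T ⊇T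
        where
        ⊆T : Tail t ∖N[ leaf j≤ℓ ] ⊆ Tail (2 + double j)
        ⊆T {y} y∈ = ∈Tail⁺ (≤∧≢⇒< (≤∧≢⇒< (≤-trans 2j≤t (∈Tail⁻ (proj₁ (∈∖N⁻ y∈)))) ≢spine) ≢leaf)
          where
          ≢spine : double j ≢ toℕ y
          ≢spine = proj₂ (proj₂ (∈∖N⁻ y∈)) ∘ leaf-edge ∘ sym
          ≢leaf : suc (double j) ≢ toℕ y
          ≢leaf y≡ = proj₁ (proj₂ (∈∖N⁻ y∈)) (toℕ-injective (trans (sym y≡) (sym toℕ-leaf)))
        ⊇T : Tail (2 + double j) ⊆ Tail t ∖N[ leaf j≤ℓ ]
        ⊇T {y} y∈ = ∈∖N⁺ (∈Tail⁺ (≤-trans t≤2j+1 (<⇒≤ 2j+1<y))) y≢leaf leaf≁y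
          where
          2j+1<y : suc (double j) < toℕ y
          2j+1<y = ∈Tail⁻ y∈
          y≢leaf : y ≢ leaf j≤ℓ
          y≢leaf refl = <-irrefl (sym toℕ-leaf) 2j+1<y
          leaf≁y : ¬ Edge comb (leaf j≤ℓ) y
          leaf≁y leaf~y = <-irrefl (sym (leaf-neighbour leaf~y)) (<-trans (n<1+n _) 2j+1<y)

    module _ {j : ℕ} (j<ℓ : j < ℓ) where
      private
        j≤ℓ = <⇒≤ j<ℓ

      spine-neighbour : ∀ {y} → Edge comb (spine j≤ℓ) y → double j < toℕ y →
        toℕ y ≡ suc (double j) ⊎ toℕ y ≡ 2 + double j
      spine-neighbour spine~y 2j<y with Edge⇒ParentOf (combParent< ℓ) spine~y
      ... | inj₁ (pos , spine≡) = combParent-children j<ℓ pos (trans (sym spine≡) (toℕ-spine j≤ℓ))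
      ... | inj₂ y-parent =
        ⊥-elim (<-asym 2j<y (subst (_ <_) (toℕ-spine j≤ℓ) (ParentOf⇒< (combParent< ℓ) y-parent)))

      spine-next-edge : ∀ {y} → toℕ y ≡ 2 + double j → Edge comb (spine j≤ℓ) y
      spine-next-edge y≡ = ParentOf⇒Edge (combParent< ℓ) (inj₁ (subst (0 <_) (sym y≡) (s≤s z≤n) ,
        trans (toℕ-spine j≤ℓ) (sym (trans (cong (combParent ℓ) y≡) (combParent-next j<ℓ)))))

      ∖N[spine] : Tail (double j) ∖N[ spine j≤ℓ ] ≡ Tail (3 + double j)
      ∖N[spine] = ⊆-antisym ⊆T ⊇T
        where
        ⊆T : Tail (double j) ∖N[ spine j≤ℓ ] ⊆ Tail (3 + double j)
        ⊆T {y} y∈ = ∈Tail⁺ (≤∧≢⇒< (≤∧≢⇒< (≤∧≢⇒< (∈Tail⁻ (proj₁ (∈∖N⁻ y∈))) ≢spine) ≢leaf) ≢next)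
          where
          spine≁y = proj₂ (proj₂ (∈∖N⁻ y∈))
          ≢spine : double j ≢ toℕ y
          ≢spine y≡ = proj₁ (proj₂ (∈∖N⁻ y∈)) (toℕ-injective (trans (sym y≡) (sym (toℕ-spine j≤ℓ))))
          ≢leaf : suc (double j) ≢ toℕ y
          ≢leaf y≡ = spine≁y (subst (Edge comb (spine j≤ℓ)) (toℕ-injective (trans (toℕ-leaf j≤ℓ) y≡))
                                    (Edge-sym {leaf j≤ℓ} (leaf-edge j≤ℓ (toℕ-spine j≤ℓ))))
          ≢next : 2 + double j ≢ toℕ y
          ≢next = spine≁y ∘ spine-next-edge ∘ sym
        ⊇T : Tail (3 + double j) ⊆ Tail (double j) ∖N[ spine j≤ℓ ]
        ⊇T {y} y∈ = ∈∖N⁺ (∈Tail⁺ (<⇒≤ 2j<y)) y≢spine spine≁y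
          where
          2j+3≤y = ∈Tail⁻ y∈
          2j<y : double j < toℕ y
          2j<y = ≤-trans (m≤n+m _ 2) 2j+3≤y
          y≢spine : y ≢ spine j≤ℓ
          y≢spine refl = <-irrefl (sym (toℕ-spine j≤ℓ)) 2j<y
          spine≁y : ¬ Edge comb (spine j≤ℓ) y
          spine≁y spine~y with spine-neighbour spine~y 2j<y
          ... | inj₁ y≡ = <-irrefl (sym y≡) (≤-trans (n≤1+n _) 2j+3≤y)
          ... | inj₂ y≡ = <-irrefl (sym y≡) 2j+3≤y

      leaf-isolated : ∀ {y} → y ∈ Tail (suc (double j)) → ¬ Edge comb (leaf j≤ℓ) y
      leaf-isolated y∈ leaf~y = <-irrefl (sym (leaf-neighbour j≤ℓ leaf~y)) (∈Tail⁻ y∈)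

    misIn-Tail : ∀ d j → d + j ≡ ℓ →
      misIn (Tail (double j)) ≡ fib (suc d + 2) × misIn (Tail (suc (double j))) ≡ fib (d + 2)
    misIn-Tail zero j refl = even , odd
      where
      odd : misIn (Tail (suc (double ℓ))) ≡ 1
      odd = misIn-edgeless (Tail-edgeless ≤-refl)
      even : misIn (Tail (double ℓ)) ≡ 2
      even = begin
        misIn (Tail (double ℓ))
          ≡⟨ misIn-pendant (pendant ≤-refl) ⟩
        misIn (Tail (double ℓ) ∖N[ spine ≤-refl ]) + misIn (Tail (double ℓ) ∖N[ leaf ≤-refl ])
          ≡⟨ cong₂ _+_
               (misIn-edgeless λ a∈ b∈ →
                 Tail-edgeless ≤-refl (beyond-spine-vertex a∈) (beyond-spine-vertex b∈))
               (trans (cong misIn (∖N[leaf] ≤-refl ≤-refl (n≤1+n _)))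
                      (misIn-edgeless (Tail-edgeless (n≤1+n _)))) ⟩
        2 ∎
        where
        open ≡-Reasoning
        beyond-spine-vertex : ∀ {y} → y ∈ Tail (double ℓ) ∖N[ spine ≤-refl ] → y ∈ Tail (suc (double ℓ))
        beyond-spine-vertex y∈ = let (y∈T , y≢spine , _) = ∈∖N⁻ y∈ in ∈Tail⁺ (≤∧≢⇒< (∈Tail⁻ y∈T)
          λ y≡ → y≢spine (toℕ-injective (trans (sym y≡) (sym (toℕ-spine ≤-refl)))))
    misIn-Tail (suc d) j d+1+j≡ℓ = even , odd
      where
      j<ℓ : j < ℓ
      j<ℓ = subst (j <_) d+1+j≡ℓ (s≤s (m≤n+m j d))
      j≤ℓ = <⇒≤ j<ℓ
      next = misIn-Tail d (suc j) (trans (+-suc d j) d+1+j≡ℓ)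
      odd : misIn (Tail (suc (double j))) ≡ fib (suc d + 2)
      odd = begin
        misIn (Tail (suc (double j)))
          ≡⟨ misIn-isolated (∈Tail⁺ (≤-reflexive (sym (toℕ-leaf j≤ℓ)))) (leaf-isolated j<ℓ) ⟩
        misIn (Tail (suc (double j)) ∖N[ leaf j≤ℓ ])
          ≡⟨ cong misIn (∖N[leaf] j≤ℓ (n≤1+n _) ≤-refl) ⟩
        misIn (Tail (2 + double j))
          ≡⟨ proj₁ next ⟩
        fib (suc d + 2) ∎
        where open ≡-Reasoning
      even : misIn (Tail (double j)) ≡ fib (suc (suc d) + 2)
      even = begin
        misIn (Tail (double j))
          ≡⟨ misIn-pendant (pendant j≤ℓ) ⟩
        misIn (Tail (double j) ∖N[ spine j≤ℓ ]) + misIn (Tail (double j) ∖N[ leaf j≤ℓ ])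
          ≡⟨ cong₂ _+_ (cong misIn (∖N[spine] j<ℓ)) (cong misIn (∖N[leaf] j≤ℓ ≤-refl (n≤1+n _))) ⟩
        misIn (Tail (3 + double j)) + misIn (Tail (2 + double j))
          ≡⟨ cong₂ _+_ (proj₂ next) (proj₁ next) ⟩
        fib (d + 2) + fib (suc d + 2)
          ≡⟨ +-comm (fib (d + 2)) (fib (suc d + 2)) ⟩
        fib (suc (suc d) + 2) ∎
        where open ≡-Reasoning

    deficit-Tail : ∀ d j → d + j ≡ suc ℓ →
      DeficitAtLeast d (Tail (double j)) × DeficitAtMost d (Tail (double j))
    deficit-Tail zero _ refl = deficitAtLeast-0 _ ,
      (_ , (λ y∈ → y∈) , Edgeless⇒Independent (Tail-edgeless (n≤1+n _)) ,
       ≤-reflexive (sym (+-identityʳ _)))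
    deficit-Tail (suc d) j d+1+j≡ℓ+1 =
      let (atLeast , atMost) = subst (λ W → DeficitAtLeast d W × DeficitAtMost d W)
                                     (sym (∖N[leaf] j≤ℓ ≤-refl (n≤1+n _)))
                                     (deficit-Tail d (suc j) (trans (+-suc d j) d+1+j≡ℓ+1)) in
      deficitAtLeast-pendant⁺ (pendant j≤ℓ) atLeast , deficitAtMost-pendant (pendant j≤ℓ) atMost
      where
      j≤ℓ : j ≤ ℓ
      j≤ℓ = subst (j ≤_) (suc-injective d+1+j≡ℓ+1) (m≤n+m j d)

    comb-isTree : IsTree comb
    comb-isTree = 0<n , parentGraph-connected (combParent< ℓ) 0<n , parentGraph-acyclic (combParent< ℓ)
      where 0<n = ≤-trans (s≤s z≤n) room

    comb-mis : mis comb ≡ fib (suc ℓ + 2)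
    comb-mis = begin
      mis comb         ≡⟨ misIn-⊤ ⟩
      misIn ⊤          ≡⟨ cong misIn Tail-0 ⟨
      misIn (Tail 0)   ≡⟨ proj₁ (misIn-Tail ℓ 0 (+-identityʳ ℓ)) ⟩
      fib (suc ℓ + 2)  ∎
      where open ≡-Reasoning

    comb-α : IsIndependenceNumber comb (n ∸ suc ℓ)
    comb-α = let (atLeast , atMost) = deficit-Tail (suc ℓ) 0 (cong suc (+-identityʳ ℓ)) in
      deficit⇒IsIndependenceNumber (subst (DeficitAtLeast (suc ℓ)) Tail-0 atLeast)
                                   (subst (DeficitAtMost (suc ℓ)) Tail-0 atMost)

comb-size : ∀ {n α} → ⌈ n /2⌉ ≤ α → α < n → ∃[ ℓ ] n ∸ α ≡ suc ℓ × 2 + double ℓ ≤ n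
comb-size {n} {α} ⌈n/2⌉≤α α<n = n ∸ suc α , +-∸-assoc 1 α<n ,
  subst (λ k → double k ≤ n) (+-∸-assoc 1 α<n) (begin
    double (n ∸ α)       ≡⟨ double≡+ (n ∸ α) ⟩
    (n ∸ α) + (n ∸ α)    ≤⟨ +-monoʳ-≤ (n ∸ α) (m≤n+o⇒m∸n≤o n α n≤α+α) ⟩
    (n ∸ α) + α          ≡⟨ m∸n+n≡m (<⇒≤ α<n) ⟩
    n                    ∎)
  where
  open ≤-Reasoning
  n≤α+α : n ≤ α + α
  n≤α+α = begin
    n                    ≡⟨ ⌊n/2⌋+⌈n/2⌉≡n n ⟨
    ⌊ n /2⌋ + ⌈ n /2⌉    ≤⟨ +-mono-≤ (≤-trans (⌊n/2⌋≤⌈n/2⌉ n) ⌈n/2⌉≤α) ⌈n/2⌉≤α ⟩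
    α + α                ∎

theorem1 :
    ((n : ℕ) (T : Graph n) (α : ℕ) → IsTree T → IsIndependenceNumber T α →
      fib (n ∸ α + 2) ≤ mis T)
    ×
    ((n α : ℕ) → 2 ≤ n → ⌈ n /2⌉ ≤ α → α ≤ n ∸ 1 →
      Σ (Graph n) λ T → IsTree T × IsIndependenceNumber T α × mis T ≡ fib (n ∸ α + 2))
theorem1 = lower-bound , sharpness
  where
  lower-bound : (n : ℕ) (T : Graph n) (α : ℕ) → IsTree T → IsIndependenceNumber T α →
    fib (n ∸ α + 2) ≤ mis T
  lower-bound n T α (_ , _ , acyclic) α-T = subst (fib (n ∸ α + 2) ≤_) (sym misIn-⊤)
    (misIn-lower-bound acyclic (IsIndependenceNumber⇒deficitAtLeast α-T))
    where open Induced T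
  sharpness : (n α : ℕ) → 2 ≤ n → ⌈ n /2⌉ ≤ α → α ≤ n ∸ 1 →
    Σ (Graph n) λ T → IsTree T × IsIndependenceNumber T α × mis T ≡ fib (n ∸ α + 2)
  sharpness (suc m) α _ ⌈n/2⌉≤α α≤m with comb-size ⌈n/2⌉≤α (s≤s α≤m)
  ... | ℓ , n∸α≡1+ℓ , room =
    comb ℓ , comb-isTree ℓ room , subst (IsIndependenceNumber (comb ℓ)) α≡ (comb-α ℓ room) ,
    trans (comb-mis ℓ room) (cong (λ k → fib (k + 2)) (sym n∸α≡1+ℓ))
    where
    α≡ : suc m ∸ suc ℓ ≡ α
    α≡ = trans (cong (suc m ∸_) (sym n∸α≡1+ℓ)) (m∸[m∸n]≡n (m≤n⇒m≤1+n α≤m))
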